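{- Let $X$ be a $(95,40,12,20)$ strongly regular graph and let $K$ be a $4$-clique of $X$ that is not contained in any $5$-clique of $X$. For $i\in\{0,1,2,3\}$ let $X_i$ be the set of vertices of $V(X)\setminus V(K)$ having exactly $i$ neighbours in $K$, and suppose $(|X_0|,|X_1|,|X_2|,|X_3|)=(2,31,57,1)$. Write $X_0=\{x_0,x_1\}$. Then each of $x_0,x_1$ has exactly one neighbour in $X_1$, and these two neighbours are distinct. Moreover, each of $x_0,x_1$ has exactly $38$ neighbours in $X_2$, and exactly $19$ vertices of $X_2$ are adjacent to both $x_0$ and $x_1$.
   Context: A $k$-regular graph $G$ on $v$ vertices is a $(v,k,\lambda,\mu)$ strongly regular graph if any two distinct adjacent vertices have exactly $\lambda$ common neighbours and any two distinct non-adjacent vertices have exactly $\mu$ common neighbours. -}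

module Defs where

open import Data.Nat using (ℕ; zero; suc; _+_; _≡ᵇ_)
open import Data.Fin using (Fin; zero; suc)
open import Data.Bool using (Bool; true; false; if_then_else_; _∧_; not)
open import Data.Product using (Σ; _×_; ∃)
open import Relation.Binary.PropositionalEquality using (_≡_; _≢_)
open import Relation.Nullary using (¬_)

count : {n : ℕ} → (Fin n → Bool) → ℕ
count {zero}  P = 0
count {suc n} P = (if P zero then 1 else 0) + count (λ i → P (suc i))

record Graph (v : ℕ) : Set where
  field
    adj   : Fin v → Fin v → Bool
    sym   : ∀ x y → adj x y ≡ adj y x
    irrefl : ∀ x → adj x x ≡ false

open Graph public

record IsSRG {v : ℕ} (G : Graph v) (k lam mu : ℕ) : Set where
  field
    regular  : ∀ x → count (adj G x) ≡ k
    adjCommon : ∀ x y → x ≢ y → adj G x y ≡ true →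
                count (λ z → adj G x z ∧ adj G y z) ≡ lam
    nonadjCommon : ∀ x y → x ≢ y → adj G x y ≡ false →
                count (λ z → adj G x z ∧ adj G y z) ≡ mu

Subset : ℕ → Set
Subset v = Fin v → Bool

IsClique : {v : ℕ} → Graph v → Subset v → Set
IsClique G S = ∀ x y → S x ≡ true → S y ≡ true → x ≢ y → adj G x y ≡ true

_⊆_ : {v : ℕ} → Subset v → Subset v → Set
S ⊆ T = ∀ x → S x ≡ true → T x ≡ true

IsKClique : {v : ℕ} → Graph v → ℕ → Subset v → Set
IsKClique G m S = IsClique G S × count S ≡ m

nbrsIn : {v : ℕ} → Graph v → Subset v → Fin v → ℕ
nbrsIn G S x = count (λ y → S y ∧ adj G x y)

layer : {v : ℕ} → Graph v → Subset v → ℕ → Subset v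
layer G K i x = not (K x) ∧ (nbrsIn G K x ≡ᵇ i)

module Submission where

-- Let A be the adjacency operator, 𝟙 S the indicator vector of S and δ p that of the vertex p.
-- For a vertex p of X₀ let nᵢ be its number of neighbours in Xᵢ. Splitting the k = 40
-- neighbours of p, and the 4μ = 80 paths of length two from p to K, along the partition
-- K, X₀, …, X₃ gives n₀ + n₁ + n₂ + n₃ = 40 and n₁ + 2n₂ + 3n₃ = 80, so n₁ = n₃ − 2n₀ and
-- n₂ = 40 + n₀ − 2n₃; here n₀ = [p ∼ x₀] + [p ∼ x₁] and n₃ = [p ∼ w] for the vertex w of X₃.
-- As n₁ ≥ 0, x₀ ≁ x₁. Since A² = 20I − 8A + 20J, the form B(f) = 24⟨f,f⟩ − 12⟨f,Af⟩ + 20(∑f)²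
-- equals ‖(A − 2)f‖² ≥ 0. On the span of 1, 𝟙 K and three vectors δ p its Gram matrix depends
-- only on how the three vertices sit relative to K and to each other, and an explicit integer
-- vector makes it negative when p ∈ X₀ is not adjacent to w, or when a vertex of X₁ is adjacent
-- to both x₀ and x₁. Hence n₁ = 1 and n₂ = 38 for x₀ and x₁, and of the 20 common neighbours of
-- x₀ and x₁ all but w lie in X₂.

open import Defs renaming (sym to adj-sym; irrefl to adj-irrefl)
open import Data.Nat as ℕ using (ℕ; zero; suc; z≤n; _≡ᵇ_)
open import Data.Nat.Properties using (≡ᵇ⇒≡)
open import Data.Fin using (Fin; zero; suc; _≟_)
open import Data.Bool using (Bool; true; false; _∧_; not; if_then_else_; T)
open import Data.Bool.Properties using (∧-idem; ∧-assoc)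
open import Data.Unit using (tt)
open import Data.Empty using (⊥; ⊥-elim)
open import Data.Product using (Σ; _×_; ∃; _,_; proj₁; proj₂)
open import Data.Integer using (ℤ; +_; -[1+_]; _+_; _*_; _-_; -_; _≤_; +≤+)
import Data.Integer.Properties as ℤP
open import Data.Integer.Tactic.RingSolver using (solve-∀)
open import Data.Vec.Functional using (Vector; []; _∷_)
open import Algebra.Properties.Semiring.Sum ℤP.+-*-semiring
  using (sum; sum-syntax; sum-cong-≗; ∑-distrib-+; ∑-comm; *-distribˡ-sum; *-distribʳ-sum)
open import Function using (_∘_)
open import Function.Definitions using (Injective)
open import Relation.Binary.PropositionalEquality
open import Relation.Nullary using (¬_; yes; no; does)
open import Relation.Nullary.Decidable using (dec-true; dec-false)

∑-const : ∀ n (c : ℤ) → ∑[ i < n ] c ≡ + n * c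
∑-const zero    c = refl
∑-const (suc n) c = begin
  c + ∑[ i < n ] c  ≡⟨ cong (λ t → c + t) (∑-const n c) ⟩
  c + + n * c       ≡⟨ lemma c (+ n) ⟩
  + suc n * c       ∎
  where
  open ≡-Reasoning
  lemma : ∀ c m → c + m * c ≡ (+ 1 + m) * c
  lemma = solve-∀

∑-mono-≤ : ∀ {n} {f g : Vector ℤ n} → (∀ i → f i ≤ g i) → sum f ≤ sum g
∑-mono-≤ {zero}  f≤g = ℤP.≤-refl
∑-mono-≤ {suc n} f≤g = ℤP.+-mono-≤ (f≤g zero) (∑-mono-≤ (f≤g ∘ suc))

private
  ≤-+-≡⇒≡ : ∀ {a b c d} → a ≤ b → c ≤ d → a + c ≡ b + d → a ≡ b
  ≤-+-≡⇒≡ {a} {b} {c} {d} a≤b c≤d eq = ℤP.≤-antisym a≤b b≤a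
    where
    open ℤP.≤-Reasoning
    cancel : ∀ x y → x ≡ x + y - y
    cancel = solve-∀
    b≤a : b ≤ a
    b≤a = begin
      b          ≡⟨ cancel b c ⟩
      b + c - c  ≤⟨ ℤP.+-monoˡ-≤ (- c) (ℤP.+-monoʳ-≤ b c≤d) ⟩
      b + d - c  ≡⟨ cong (_- c) (sym eq) ⟩
      a + c - c  ≡⟨ sym (cancel a c) ⟩
      a          ∎

≤-pointwise∧∑≡⇒≗ : ∀ {n} {f g : Vector ℤ n} → (∀ i → f i ≤ g i) → sum f ≡ sum g →
                   ∀ i → f i ≡ g i
≤-pointwise∧∑≡⇒≗ f≤g eq zero =
  ≤-+-≡⇒≡ (f≤g zero) (∑-mono-≤ (f≤g ∘ suc)) eq
≤-pointwise∧∑≡⇒≗ {f = f} {g} f≤g eq (suc i) =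
  ≤-pointwise∧∑≡⇒≗ (f≤g ∘ suc)
    (≤-+-≡⇒≡ (∑-mono-≤ (f≤g ∘ suc)) (f≤g zero)
      (trans (ℤP.+-comm (sum (f ∘ suc)) (f zero)) (trans eq (ℤP.+-comm (g zero) _))))
    i

⟦_⟧ : Bool → ℤ
⟦ true  ⟧ = + 1
⟦ false ⟧ = + 0

⟦∧⟧ : ∀ a b → ⟦ a ∧ b ⟧ ≡ ⟦ a ⟧ * ⟦ b ⟧
⟦∧⟧ true  true  = refl
⟦∧⟧ true  false = refl
⟦∧⟧ false b     = refl

0≤⟦⟧ : ∀ b → + 0 ≤ ⟦ b ⟧
0≤⟦⟧ true  = +≤+ z≤n
0≤⟦⟧ false = +≤+ z≤n

𝟙 : ∀ {n} → (Fin n → Bool) → Vector ℤ n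
𝟙 P i = ⟦ P i ⟧

count≡∑𝟙 : ∀ {n} (P : Fin n → Bool) → + count P ≡ sum (𝟙 P)
count≡∑𝟙 {zero}  P = refl
count≡∑𝟙 {suc n} P with P zero
... | true  = cong (λ t → + 1 + t) (count≡∑𝟙 (P ∘ suc))
... | false = trans (count≡∑𝟙 (P ∘ suc)) (sym (ℤP.+-identityˡ _))

count≡suc⇒∃ : ∀ {n m} (P : Fin n → Bool) → count P ≡ suc m → ∃ λ i → P i ≡ true
count≡suc⇒∃ {suc n} P eq with P zero in P0
... | true  = zero , P0
... | false with count≡suc⇒∃ (P ∘ suc) eq
...   | i , Pi = suc i , Pi

count-cong : ∀ {n} {P Q : Fin n → Bool} → (∀ i → P i ≡ Q i) → count P ≡ count Q
count-cong {zero}  P≗Q = refl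
count-cong {suc n} P≗Q = cong₂ ℕ._+_ (cong (λ b → if b then 1 else 0) (P≗Q zero)) (count-cong (P≗Q ∘ suc))

count≡0⇒false : ∀ {n} (P : Fin n → Bool) → count P ≡ 0 → ∀ i → P i ≡ false
count≡0⇒false {suc n} P eq i with P zero in P0
count≡0⇒false {suc n} P eq zero    | false = P0
count≡0⇒false {suc n} P eq (suc i) | false = count≡0⇒false (P ∘ suc) eq i

δ : ∀ {n} → Fin n → Vector ℤ n
δ i j = ⟦ does (i ≟ j) ⟧

δ-refl : ∀ {n} (i : Fin n) → δ i i ≡ + 1
δ-refl i = cong ⟦_⟧ (dec-true (i ≟ i) refl)

δ-≢ : ∀ {n} {i j : Fin n} → i ≢ j → δ i j ≡ + 0
δ-≢ {i = i} {j} i≢j = cong ⟦_⟧ (dec-false (i ≟ j) i≢j)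

δ-sym : ∀ {n} (i j : Fin n) → δ i j ≡ δ j i
δ-sym i j with i ≟ j
... | yes refl = sym (δ-refl i)
... | no  i≢j  = sym (δ-≢ (i≢j ∘ sym))

δ-injective : ∀ {m n} {f : Fin m → Fin n} → Injective _≡_ _≡_ f → ∀ i j → δ (f i) (f j) ≡ δ i j
δ-injective {f = f} f-inj i j with i ≟ j
... | yes refl = δ-refl (f i)
... | no  i≢j  = δ-≢ (i≢j ∘ f-inj)

⟨_,_⟩ : ∀ {n} → Vector ℤ n → Vector ℤ n → ℤ
⟨_,_⟩ {n} f g = ∑[ x < n ] (f x * g x)

⟨⟩-comm : ∀ {n} (f g : Vector ℤ n) → ⟨ f , g ⟩ ≡ ⟨ g , f ⟩
⟨⟩-comm f g = sum-cong-≗ (λ x → ℤP.*-comm (f x) (g x))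

⟨⟩-congˡ : ∀ {n} {f f′ : Vector ℤ n} (g : Vector ℤ n) → (∀ x → f x ≡ f′ x) → ⟨ f , g ⟩ ≡ ⟨ f′ , g ⟩
⟨⟩-congˡ g f≗f′ = sum-cong-≗ (λ x → cong (_* g x) (f≗f′ x))

⟨δ,⟩ : ∀ {n} (i : Fin n) (f : Vector ℤ n) → ⟨ δ i , f ⟩ ≡ f i
⟨δ,⟩ {suc n} zero f = begin
  + 1 * f zero + ∑[ j < n ] (+ 0 * f (suc j))  ≡⟨ cong (λ t → + 1 * f zero + t) (∑-const n (+ 0)) ⟩
  + 1 * f zero + + n * + 0                     ≡⟨ lemma (f zero) (+ n) ⟩
  f zero                                      ∎
  where
  open ≡-Reasoning
  lemma : ∀ x m → + 1 * x + m * + 0 ≡ x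
  lemma = solve-∀
⟨δ,⟩ {suc n} (suc i) f = trans (ℤP.+-identityˡ _) (⟨δ,⟩ i (f ∘ suc))

⟨,δ⟩ : ∀ {n} (f : Vector ℤ n) (i : Fin n) → ⟨ f , δ i ⟩ ≡ f i
⟨,δ⟩ f i = trans (⟨⟩-comm f (δ i)) (⟨δ,⟩ i f)

⟨1,⟩ : ∀ {n} (f : Vector ℤ n) → ⟨ (λ _ → + 1) , f ⟩ ≡ sum f
⟨1,⟩ f = sum-cong-≗ (λ x → ℤP.*-identityˡ (f x))

0≤⟨f,f⟩ : ∀ {n} (f : Vector ℤ n) → + 0 ≤ ⟨ f , f ⟩
0≤⟨f,f⟩ {n} f = subst (_≤ ⟨ f , f ⟩) (trans (∑-const n (+ 0)) (ℤP.*-zeroʳ (+ n)))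
                  (∑-mono-≤ (λ x → 0≤square (f x)))
  where
  0≤square : ∀ i → + 0 ≤ i * i
  0≤square (+ zero)  = +≤+ z≤n
  0≤square (+ suc n) = +≤+ z≤n
  0≤square -[1+ n ]  = +≤+ z≤n

∑-linear₃ : ∀ {n} (α β γ : ℤ) (f g h : Vector ℤ n) →
            ∑[ x < n ] (α * f x + β * g x + γ * h x) ≡ α * sum f + β * sum g + γ * sum h
∑-linear₃ α β γ f g h =
  trans (∑-distrib-+ (λ x → α * f x + β * g x) (λ x → γ * h x))
    (cong₂ _+_ (trans (∑-distrib-+ (λ x → α * f x) (λ x → β * g x))
                      (cong₂ _+_ (sym (*-distribˡ-sum α f)) (sym (*-distribˡ-sum β g))))
               (sym (*-distribˡ-sum γ h)))

lincomb : ∀ {m n} → Vector ℤ m → (Fin m → Vector ℤ n) → Vector ℤ n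
lincomb {m} c u x = ∑[ i < m ] (c i * u i x)

⟨lincomb,⟩ : ∀ {m n} (c : Vector ℤ m) (u : Fin m → Vector ℤ n) (g : Vector ℤ n) →
             ⟨ lincomb c u , g ⟩ ≡ ∑[ i < m ] (c i * ⟨ u i , g ⟩)
⟨lincomb,⟩ {m} {n} c u g = begin
  ∑[ x < n ] (∑[ i < m ] (c i * u i x) * g x)
    ≡⟨ sum-cong-≗ (λ x → *-distribʳ-sum (g x) (λ i → c i * u i x)) ⟩
  ∑[ x < n ] ∑[ i < m ] (c i * u i x * g x)      ≡⟨ ∑-comm (λ x i → c i * u i x * g x) ⟩
  ∑[ i < m ] ∑[ x < n ] (c i * u i x * g x)
    ≡⟨ sum-cong-≗ (λ i → sum-cong-≗ (λ x → ℤP.*-assoc (c i) (u i x) (g x))) ⟩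
  ∑[ i < m ] ∑[ x < n ] (c i * (u i x * g x))
    ≡⟨ sum-cong-≗ (λ i → sym (*-distribˡ-sum (c i) (λ x → u i x * g x))) ⟩
  ∑[ i < m ] (c i * ⟨ u i , g ⟩)                 ∎
  where open ≡-Reasoning

∑-lincomb : ∀ {m n} (c : Vector ℤ m) (u : Fin m → Vector ℤ n) →
            sum (lincomb c u) ≡ ∑[ i < m ] (c i * sum (u i))
∑-lincomb c u = begin
  sum (lincomb c u)                    ≡⟨ sym (⟨1,⟩ (lincomb c u)) ⟩
  ⟨ (λ _ → + 1) , lincomb c u ⟩        ≡⟨ ⟨⟩-comm _ (lincomb c u) ⟩
  ⟨ lincomb c u , (λ _ → + 1) ⟩        ≡⟨ ⟨lincomb,⟩ c u _ ⟩
  ∑[ i < _ ] (c i * ⟨ u i , (λ _ → + 1) ⟩)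
    ≡⟨ sum-cong-≗ (λ i → cong (c i *_) (trans (⟨⟩-comm (u i) _) (⟨1,⟩ (u i)))) ⟩
  ∑[ i < _ ] (c i * sum (u i))         ∎
  where open ≡-Reasoning

quadraticForm : ∀ {m} → (Fin m → Fin m → ℤ) → Vector ℤ m → ℤ
quadraticForm {m} M c = ∑[ i < m ] (c i * ∑[ j < m ] (c j * M i j))

⟨𝟙,𝟙⟩ : ∀ {n} (P Q : Fin n → Bool) → ⟨ 𝟙 P , 𝟙 Q ⟩ ≡ + count (λ i → P i ∧ Q i)
⟨𝟙,𝟙⟩ P Q = sym (trans (count≡∑𝟙 (λ i → P i ∧ Q i)) (sum-cong-≗ (λ i → ⟦∧⟧ (P i) (Q i))))

∑δ≡1 : ∀ {n} (i : Fin n) → sum (δ i) ≡ + 1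
∑δ≡1 i = trans (sym (⟨1,⟩ (δ i))) (⟨,δ⟩ (λ _ → + 1) i)

𝟙≡δ : ∀ {n} {S : Fin n → Bool} {p} → S p ≡ true → count S ≡ 1 → ∀ z → 𝟙 S z ≡ δ p z
𝟙≡δ {S = S} {p} p∈S |S| z = sym (≤-pointwise∧∑≡⇒≗ δ≤𝟙 (trans (∑δ≡1 p) (sym ∑𝟙)) z)
  where
  ∑𝟙 : sum (𝟙 S) ≡ + 1
  ∑𝟙 = trans (sym (count≡∑𝟙 S)) (cong +_ |S|)
  δ≤𝟙 : ∀ z → δ p z ≤ 𝟙 S z
  δ≤𝟙 z with p ≟ z
  ... | yes refl rewrite p∈S = ℤP.≤-refl
  ... | no  _    = 0≤⟦⟧ (S z)

𝟙≡δ+δ : ∀ {n} {S : Fin n → Bool} {p q} → S p ≡ true → S q ≡ true → p ≢ q → count S ≡ 2 →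
        ∀ z → 𝟙 S z ≡ δ p z + δ q z
𝟙≡δ+δ {n} {S} {p} {q} p∈S q∈S p≢q |S| z = sym (≤-pointwise∧∑≡⇒≗ δ+δ≤𝟙 ∑δ+δ z)
  where
  ∑δ+δ : ∑[ z < n ] (δ p z + δ q z) ≡ sum (𝟙 S)
  ∑δ+δ = trans (∑-distrib-+ (δ p) (δ q))
           (trans (cong₂ _+_ (∑δ≡1 p) (∑δ≡1 q)) (sym (trans (sym (count≡∑𝟙 S)) (cong +_ |S|))))
  δ+δ≤𝟙 : ∀ z → δ p z + δ q z ≤ 𝟙 S z
  δ+δ≤𝟙 z with p ≟ z | q ≟ z
  ... | yes refl | yes refl = ⊥-elim (p≢q refl)
  ... | yes refl | no  _    rewrite p∈S = ℤP.≤-refl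
  ... | no  _    | yes refl rewrite q∈S = ℤP.≤-refl
  ... | no  _    | no  _    = 0≤⟦⟧ (S z)

module Adjacency {v : ℕ} (G : Graph v) where

  a : Fin v → Fin v → ℤ
  a x y = ⟦ adj G x y ⟧

  a-sym : ∀ x y → a x y ≡ a y x
  a-sym x y = cong ⟦_⟧ (adj-sym G x y)

  a-irrefl : ∀ x → a x x ≡ + 0
  a-irrefl x = cong ⟦_⟧ (adj-irrefl G x)

  A : Vector ℤ v → Vector ℤ v
  A f x = ⟨ a x , f ⟩

  A-𝟙 : ∀ S x → A (𝟙 S) x ≡ + nbrsIn G S x
  A-𝟙 S x = trans (⟨⟩-comm (a x) (𝟙 S)) (⟨𝟙,𝟙⟩ S (adj G x))

  A-δ : ∀ p x → A (δ p) x ≡ a x p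
  A-δ p x = ⟨,δ⟩ (a x) p

  A-self-adjoint : ∀ f g → ⟨ f , A g ⟩ ≡ ⟨ A f , g ⟩
  A-self-adjoint f g = begin
    ∑[ x < v ] (f x * ∑[ z < v ] (a x z * g z))
      ≡⟨ sum-cong-≗ (λ x → *-distribˡ-sum (f x) (λ z → a x z * g z)) ⟩
    ∑[ x < v ] ∑[ z < v ] (f x * (a x z * g z))    ≡⟨ ∑-comm (λ x z → f x * (a x z * g z)) ⟩
    ∑[ z < v ] ∑[ x < v ] (f x * (a x z * g z))
      ≡⟨ sum-cong-≗ (λ z → sum-cong-≗ (λ x →
           trans (reorder (f x) (a x z) (g z)) (cong (λ t → t * f x * g z) (a-sym x z)))) ⟩
    ∑[ z < v ] ∑[ x < v ] (a z x * f x * g z)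
      ≡⟨ sum-cong-≗ (λ z → sym (*-distribʳ-sum (g z) (λ x → a z x * f x))) ⟩
    ∑[ z < v ] (A f z * g z)                       ∎
    where
    open ≡-Reasoning
    reorder : ∀ p q r → p * (q * r) ≡ q * p * r
    reorder = solve-∀

module StronglyRegular {v : ℕ} {G : Graph v} {k lam μ : ℕ} (srg : IsSRG G k lam μ) where

  open Adjacency G
  open IsSRG srg

  A-const : ∀ x → A (λ _ → + 1) x ≡ + k
  A-const x = trans (A-𝟙 (λ _ → true) x) (cong +_ (regular x))

  common-neighbours : ∀ x y → ⟨ a x , a y ⟩ ≡ + μ + (+ k - + μ) * δ x y + (+ lam - + μ) * a x y
  common-neighbours x y with x ≟ y
  ... | yes refl = begin
    ⟨ a x , a x ⟩                                       ≡⟨ ⟨𝟙,𝟙⟩ (adj G x) (adj G x) ⟩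
    + count (λ z → adj G x z ∧ adj G x z)
      ≡⟨ cong +_ (trans (count-cong (λ z → ∧-idem (adj G x z))) (regular x)) ⟩
    + k                                                 ≡⟨ lemma (+ k) (+ μ) (+ lam) ⟩
    + μ + (+ k - + μ) * + 1 + (+ lam - + μ) * + 0
      ≡⟨ cong (λ t → + μ + (+ k - + μ) * + 1 + (+ lam - + μ) * t) (sym (a-irrefl x)) ⟩
    + μ + (+ k - + μ) * + 1 + (+ lam - + μ) * a x x     ∎
    where
    open ≡-Reasoning
    lemma : ∀ k μ lam → k ≡ μ + (k - μ) * + 1 + (lam - μ) * + 0
    lemma = solve-∀
  ... | no x≢y with adj G x y in xy
  ...   | true  = trans (⟨𝟙,𝟙⟩ (adj G x) (adj G y))
                        (trans (cong +_ (adjCommon x y x≢y xy)) (lemma (+ k) (+ μ) (+ lam)))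
    where
    lemma : ∀ k μ lam → lam ≡ μ + (k - μ) * + 0 + (lam - μ) * + 1
    lemma = solve-∀
  ...   | false = trans (⟨𝟙,𝟙⟩ (adj G x) (adj G y))
                        (trans (cong +_ (nonadjCommon x y x≢y xy)) (lemma (+ k) (+ μ) (+ lam)))
    where
    lemma : ∀ k μ lam → μ ≡ μ + (k - μ) * + 0 + (lam - μ) * + 0
    lemma = solve-∀

  A² : ∀ f x → A (A f) x ≡ (+ k - + μ) * f x + (+ lam - + μ) * A f x + + μ * sum f
  A² f x = begin
    ⟨ a x , A f ⟩
      ≡⟨ A-self-adjoint (a x) f ⟩
    ⟨ A (a x) , f ⟩
      ≡⟨ sum-cong-≗ expand ⟩
    ∑[ z < v ] ((+ k - + μ) * (δ x z * f z) + (+ lam - + μ) * (a x z * f z) + + μ * f z)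
      ≡⟨ ∑-linear₃ (+ k - + μ) (+ lam - + μ) (+ μ) (λ z → δ x z * f z) (λ z → a x z * f z) f ⟩
    (+ k - + μ) * ⟨ δ x , f ⟩ + (+ lam - + μ) * A f x + + μ * sum f
      ≡⟨ cong (λ t → (+ k - + μ) * t + (+ lam - + μ) * A f x + + μ * sum f) (⟨δ,⟩ x f) ⟩
    (+ k - + μ) * f x + (+ lam - + μ) * A f x + + μ * sum f ∎
    where
    open ≡-Reasoning
    distribute : ∀ m α β d e y → (m + α * d + β * e) * y ≡ α * (d * y) + β * (e * y) + m * y
    distribute = solve-∀
    expand : ∀ z → ⟨ a z , a x ⟩ * f z
                 ≡ (+ k - + μ) * (δ x z * f z) + (+ lam - + μ) * (a x z * f z) + + μ * f z
    expand z rewrite common-neighbours z x | δ-sym z x | a-sym z x =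
      distribute (+ μ) (+ k - + μ) (+ lam - + μ) (δ x z) (a x z) (f z)

  α β : ℤ → ℤ
  α r = + k - + μ + r * r
  β r = + lam - + μ - + 2 * r

  -- B r is the polarisation of f ↦ ‖(A − r) f‖², expanded by means of A².
  B : ℤ → Vector ℤ v → Vector ℤ v → ℤ
  B r f g = α r * ⟨ f , g ⟩ + β r * ⟨ f , A g ⟩ + + μ * (sum f * sum g)

  B-diagonal : ∀ r f → B r f f ≡ ⟨ (λ x → A f x - r * f x) , (λ x → A f x - r * f x) ⟩
  B-diagonal r f = sym (begin
    ∑[ x < v ] ((A f x - r * f x) * (A f x - r * f x))
        ≡⟨ sum-cong-≗ (λ x → square (A f x) (f x) r) ⟩
    ∑[ x < v ] (+ 1 * (A f x * A f x) + - (+ 2 * r) * (f x * A f x) + r * r * (f x * f x))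
        ≡⟨ ∑-linear₃ (+ 1) (- (+ 2 * r)) (r * r) (λ x → A f x * A f x) (λ x → f x * A f x) (λ x → f x * f x) ⟩
    + 1 * ⟨ A f , A f ⟩ + - (+ 2 * r) * Q + r * r * P
        ≡⟨ cong (λ t → + 1 * t + - (+ 2 * r) * Q + r * r * P) ‖Af‖² ⟩
    + 1 * ((+ k - + μ) * P + (+ lam - + μ) * Q + + μ * S * S) + - (+ 2 * r) * Q + r * r * P
        ≡⟨ collect (+ k) (+ μ) (+ lam) r P Q S ⟩
    B r f f ∎)
    where
    open ≡-Reasoning
    P Q S : ℤ
    P = ⟨ f , f ⟩
    Q = ⟨ f , A f ⟩
    S = sum f
    square : ∀ y z r → (y - r * z) * (y - r * z) ≡ + 1 * (y * y) + - (+ 2 * r) * (z * y) + r * r * (z * z)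
    square = solve-∀
    collect : ∀ k μ lam r P Q S →
      + 1 * ((k - μ) * P + (lam - μ) * Q + μ * S * S) + - (+ 2 * r) * Q + r * r * P
      ≡ (k - μ + r * r) * P + (lam - μ - + 2 * r) * Q + μ * (S * S)
    collect = solve-∀
    ‖Af‖² : ⟨ A f , A f ⟩ ≡ (+ k - + μ) * P + (+ lam - + μ) * Q + + μ * S * S
    ‖Af‖² = begin
      ⟨ A f , A f ⟩
        ≡⟨ sym (A-self-adjoint f (A f)) ⟩
      ⟨ f , A (A f) ⟩
        ≡⟨ sum-cong-≗ (λ x → trans (cong (f x *_) (A² f x)) (distribute (f x) (A f x))) ⟩
      ∑[ x < v ] ((+ k - + μ) * (f x * f x) + (+ lam - + μ) * (f x * A f x) + + μ * S * f x)
        ≡⟨ ∑-linear₃ (+ k - + μ) (+ lam - + μ) (+ μ * S) (λ x → f x * f x) (λ x → f x * A f x) f ⟩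
      (+ k - + μ) * P + (+ lam - + μ) * Q + + μ * S * S ∎
      where
      distribute : ∀ y y′ → y * ((+ k - + μ) * y + (+ lam - + μ) * y′ + + μ * S)
                          ≡ (+ k - + μ) * (y * y) + (+ lam - + μ) * (y * y′) + + μ * S * y
      distribute y y′ = lemma (+ k) (+ μ) (+ lam) S y y′
        where
        lemma : ∀ k μ lam S y y′ → y * ((k - μ) * y + (lam - μ) * y′ + μ * S)
                                   ≡ (k - μ) * (y * y) + (lam - μ) * (y * y′) + μ * S * y
        lemma = solve-∀

  B-nonneg : ∀ r f → + 0 ≤ B r f f
  B-nonneg r f = subst (+ 0 ≤_) (sym (B-diagonal r f)) (0≤⟨f,f⟩ (λ x → A f x - r * f x))

  B-sym : ∀ r f g → B r f g ≡ B r g f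
  B-sym r f g =
    cong₂ _+_ (cong₂ _+_ (cong (α r *_) (⟨⟩-comm f g))
                         (cong (β r *_) (trans (A-self-adjoint f g) (⟨⟩-comm (A f) g))))
              (cong (+ μ *_) (ℤP.*-comm (sum f) (sum g)))

  B-linearˡ : ∀ r {m} (c : Vector ℤ m) (u : Fin m → Vector ℤ v) g →
              B r (lincomb c u) g ≡ ∑[ i < m ] (c i * B r (u i) g)
  B-linearˡ r {m} c u g = begin
    α r * ⟨ lincomb c u , g ⟩ + β r * ⟨ lincomb c u , A g ⟩ + + μ * (sum (lincomb c u) * sum g)
        ≡⟨ cong₂ _+_ (cong₂ _+_ (cong (α r *_) (⟨lincomb,⟩ c u g)) (cong (β r *_) (⟨lincomb,⟩ c u (A g))))
                     (cong (λ t → + μ * (t * sum g)) (∑-lincomb c u)) ⟩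
    α r * X + β r * Y + + μ * (Z * sum g)
        ≡⟨ reassociate (α r) (β r) (+ μ) X Y Z (sum g) ⟩
    α r * X + β r * Y + + μ * sum g * Z
        ≡⟨ sym (∑-linear₃ (α r) (β r) (+ μ * sum g)
                 (λ i → c i * ⟨ u i , g ⟩) (λ i → c i * ⟨ u i , A g ⟩) (λ i → c i * sum (u i))) ⟩
    ∑[ i < m ] (α r * (c i * ⟨ u i , g ⟩) + β r * (c i * ⟨ u i , A g ⟩) + + μ * sum g * (c i * sum (u i)))
        ≡⟨ sum-cong-≗ (λ i → distribute (α r) (β r) (+ μ) (c i) ⟨ u i , g ⟩ ⟨ u i , A g ⟩ (sum (u i)) (sum g)) ⟩
    ∑[ i < m ] (c i * B r (u i) g) ∎
    where
    open ≡-Reasoning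
    X Y Z : ℤ
    X = ∑[ i < m ] (c i * ⟨ u i , g ⟩)
    Y = ∑[ i < m ] (c i * ⟨ u i , A g ⟩)
    Z = ∑[ i < m ] (c i * sum (u i))
    reassociate : ∀ a b m x y z s → a * x + b * y + m * (z * s) ≡ a * x + b * y + m * s * z
    reassociate = solve-∀
    distribute : ∀ a b m c p q t s →
                 a * (c * p) + b * (c * q) + m * s * (c * t) ≡ c * (a * p + b * q + m * (t * s))
    distribute = solve-∀

  B-psd : ∀ r {m} (u : Fin m → Vector ℤ v) (c : Vector ℤ m) →
          + 0 ≤ quadraticForm (λ i j → B r (u i) (u j)) c
  B-psd r {m} u c = subst (+ 0 ≤_) expansion (B-nonneg r (lincomb c u))
    where
    expansion : B r (lincomb c u) (lincomb c u) ≡ quadraticForm (λ i j → B r (u i) (u j)) c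
    expansion = trans (B-linearˡ r c u (lincomb c u))
      (sum-cong-≗ (λ i → cong (c i *_)
        (trans (B-sym r (u i) (lincomb c u))
          (trans (B-linearˡ r c u (u i)) (sum-cong-≗ (λ j → cong (c j *_) (B-sym r (u j) (u i))))))))

module Layers {v : ℕ} (G : Graph v) (K : Subset v) where

  layer-outside : ∀ {i x} → layer G K i x ≡ true → K x ≡ false
  layer-outside {i} {x} x∈Xᵢ with K x
  ... | false = refl

  layer-nbrsIn : ∀ {i x} → layer G K i x ≡ true → nbrsIn G K x ≡ i
  layer-nbrsIn {i} {x} x∈Xᵢ with K x
  ... | false = ≡ᵇ⇒≡ (nbrsIn G K x) i (subst T (sym x∈Xᵢ) tt)

  layers-disjoint : ∀ {i j x y} → layer G K i x ≡ true → layer G K j y ≡ true → i ≢ j → x ≢ y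
  layers-disjoint x∈Xᵢ y∈Xⱼ i≢j refl = i≢j (trans (sym (layer-nbrsIn x∈Xᵢ)) (layer-nbrsIn y∈Xⱼ))

  parts : Fin 5 → Subset v
  parts = K ∷ layer G K 0 ∷ layer G K 1 ∷ layer G K 2 ∷ layer G K 3 ∷ []

  -- The values of 𝟙 (parts i) at z as a function of b = K z and n = nbrsIn G K z, so that
  -- a case analysis on b and n evaluates them.
  membership : Bool → ℕ → Vector ℤ 5
  membership b n = ⟦ b ⟧ ∷ ⟦ not b ∧ (n ≡ᵇ 0) ⟧ ∷ ⟦ not b ∧ (n ≡ᵇ 1) ⟧ ∷ ⟦ not b ∧ (n ≡ᵇ 2) ⟧
                   ∷ ⟦ not b ∧ (n ≡ᵇ 3) ⟧ ∷ []

  membership-at-most-one : ∀ b n → ∑[ i < 5 ] (+ 1 * membership b n i) ≤ + 1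
  membership-at-most-one true  n = ℤP.≤-refl
  membership-at-most-one false 0 = ℤP.≤-refl
  membership-at-most-one false 1 = ℤP.≤-refl
  membership-at-most-one false 2 = ℤP.≤-refl
  membership-at-most-one false 3 = ℤP.≤-refl
  membership-at-most-one false (suc (suc (suc (suc n)))) = +≤+ z≤n

  parts-cover : ∑[ i < 5 ] (+ count (parts i)) ≡ + v → ∀ z → lincomb (λ _ → + 1) (𝟙 ∘ parts) z ≡ + 1
  parts-cover total = ≤-pointwise∧∑≡⇒≗ (λ z → membership-at-most-one (K z) (nbrsIn G K z)) (begin
    sum (lincomb (λ _ → + 1) (𝟙 ∘ parts))       ≡⟨ ∑-lincomb (λ _ → + 1) (𝟙 ∘ parts) ⟩
    ∑[ i < 5 ] (+ 1 * sum (𝟙 (parts i)))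
      ≡⟨ sum-cong-≗ (λ i → trans (ℤP.*-identityˡ _) (sym (count≡∑𝟙 (parts i)))) ⟩
    ∑[ i < 5 ] (+ count (parts i))               ≡⟨ total ⟩
    + v
      ≡⟨ sym (trans (∑-const v (+ 1)) (ℤP.*-identityʳ (+ v))) ⟩
    ∑[ z < v ] (+ 1)                            ∎)
    where open ≡-Reasoning

record Configuration (m : ℕ) : Set where
  field
    nbrsInK  : Fin m → ℕ
    adjacent : Fin m → Fin m → Bool

triple : (n₀ n₁ n₂ : ℕ) (b₀₁ b₀₂ b₁₂ : Bool) → Configuration 3
triple n₀ n₁ n₂ b₀₁ b₀₂ b₁₂ = record
  { nbrsInK  = n₀ ∷ n₁ ∷ n₂ ∷ []
  ; adjacent = (false ∷ b₀₁ ∷ b₀₂ ∷ []) ∷ (b₀₁ ∷ false ∷ b₁₂ ∷ []) ∷ (b₀₂ ∷ b₁₂ ∷ false ∷ []) ∷ []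
  }

module Clique {v : ℕ} {G : Graph v} {k lam μ : ℕ} (srg : IsSRG G k lam μ)
              (K : Subset v) (K-clique : IsClique G K) {s : ℕ} (K-size : count K ≡ s) where

  open Adjacency G
  open StronglyRegular srg
  open Layers G K

  ∑𝟙K : sum (𝟙 K) ≡ + s
  ∑𝟙K = trans (sym (count≡∑𝟙 K)) (cong +_ K-size)

  A𝟙K-inside : ∀ {x} → K x ≡ true → A (𝟙 K) x ≡ + s - + 1
  A𝟙K-inside {x} x∈K = begin
    A (𝟙 K) x                                    ≡⟨ cancel (A (𝟙 K) x) (sum (δ x)) ⟩
    A (𝟙 K) x + sum (δ x) - sum (δ x)            ≡⟨ cong₂ _-_ ∑-with-x (∑δ≡1 x) ⟩
    + s - + 1                                ∎
    where
    open ≡-Reasoning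
    cancel : ∀ t u → t ≡ t + u - u
    cancel = solve-∀
    pointwise : ∀ y → a x y * 𝟙 K y + δ x y ≡ 𝟙 K y
    pointwise y with x ≟ y
    ... | yes refl rewrite a-irrefl x | x∈K = refl
    ... | no x≢y with K y in y∈K
    ...   | true  rewrite K-clique x y x∈K y∈K x≢y = refl
    ...   | false = trans (ℤP.+-identityʳ _) (ℤP.*-zeroʳ (a x y))
    ∑-with-x : A (𝟙 K) x + sum (δ x) ≡ + s
    ∑-with-x = trans (sym (∑-distrib-+ (λ y → a x y * 𝟙 K y) (δ x))) (trans (sum-cong-≗ pointwise) ∑𝟙K)

  weights : Vector ℤ 5
  weights = (+ s - + 1) ∷ + 0 ∷ + 1 ∷ + 2 ∷ + 3 ∷ []

  A𝟙K-by-parts : (∀ z → lincomb (λ _ → + 1) (𝟙 ∘ parts) z ≡ + 1) →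
                 ∀ z → A (𝟙 K) z ≡ lincomb weights (𝟙 ∘ parts) z
  A𝟙K-by-parts cover z = trans (A𝟙K-cases z) (weighted (K z) (nbrsIn G K z) (cover z))
    where
    A𝟙K-cases : ∀ z → A (𝟙 K) z ≡ (if K z then + s - + 1 else + nbrsIn G K z)
    A𝟙K-cases z with K z in z∈K
    ... | true  = A𝟙K-inside z∈K
    ... | false = A-𝟙 K z
    pad : ∀ t m → m ≡ t * + 0 + m
    pad = solve-∀
    weighted : ∀ b n → ∑[ i < 5 ] (+ 1 * membership b n i) ≡ + 1 →
               (if b then + s - + 1 else + n) ≡ ∑[ i < 5 ] (weights i * membership b n i)
    weighted true  n _ = sym (trans (ℤP.+-identityʳ _) (ℤP.*-identityʳ _))
    weighted false 0 _ = pad (+ s - + 1) (+ 0)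
    weighted false 1 _ = pad (+ s - + 1) (+ 1)
    weighted false 2 _ = pad (+ s - + 1) (+ 2)
    weighted false 3 _ = pad (+ s - + 1) (+ 3)
    weighted false (suc (suc (suc (suc n)))) ()

  family : ∀ {m} → (Fin m → Fin v) → Fin (suc (suc m)) → Vector ℤ v
  family p = (λ _ → + 1) ∷ 𝟙 K ∷ δ ∘ p

  module _ {m : ℕ} (C : Configuration m) where
    open Configuration C

    inner innerA : Fin (suc (suc m)) → Fin (suc (suc m)) → ℤ
    inner zero          zero          = + v
    inner zero          (suc zero)    = + s
    inner zero          (suc (suc j)) = + 1
    inner (suc zero)    zero          = + s
    inner (suc zero)    (suc zero)    = + s
    inner (suc zero)    (suc (suc j)) = + 0
    inner (suc (suc i)) zero          = + 1
    inner (suc (suc i)) (suc zero)    = + 0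
    inner (suc (suc i)) (suc (suc j)) = δ i j

    innerA zero          zero          = + v * + k
    innerA zero          (suc zero)    = + k * + s
    innerA zero          (suc (suc j)) = + k
    innerA (suc zero)    zero          = + s * + k
    innerA (suc zero)    (suc zero)    = + s * (+ s - + 1)
    innerA (suc zero)    (suc (suc j)) = + nbrsInK j
    innerA (suc (suc i)) zero          = + k
    innerA (suc (suc i)) (suc zero)    = + nbrsInK i
    innerA (suc (suc i)) (suc (suc j)) = ⟦ adjacent i j ⟧

    sums : Fin (suc (suc m)) → ℤ
    sums = + v ∷ + s ∷ λ _ → + 1

    gram : ℤ → Fin (suc (suc m)) → Fin (suc (suc m)) → ℤ
    gram r i j = α r * inner i j + β r * innerA i j + + μ * (sums i * sums j)

  record Realises {m : ℕ} (C : Configuration m) (p : Fin m → Fin v) : Set where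
    field
      injective        : Injective _≡_ _≡_ p
      outside-K        : ∀ i → K (p i) ≡ false
      matches-nbrsInK  : ∀ i → nbrsIn G K (p i) ≡ Configuration.nbrsInK C i
      matches-adjacent : ∀ i j → adj G (p i) (p j) ≡ Configuration.adjacent C i j

  module _ {m : ℕ} {C : Configuration m} {p : Fin m → Fin v} (R : Realises C p) where
    open Realises R

    private
      ⟨1,A⟩ : ∀ f → ⟨ (λ _ → + 1) , A f ⟩ ≡ + k * sum f
      ⟨1,A⟩ f = trans (A-self-adjoint _ f)
        (trans (sum-cong-≗ (λ x → cong (_* f x) (A-const x))) (sym (*-distribˡ-sum (+ k) f)))

      ⟨,A1⟩ : ∀ f → ⟨ f , A (λ _ → + 1) ⟩ ≡ sum f * + k
      ⟨,A1⟩ f = trans (sum-cong-≗ (λ x → cong (f x *_) (A-const x))) (sym (*-distribʳ-sum (+ k) f))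

      ⟨𝟙K,A𝟙K⟩ : ⟨ 𝟙 K , A (𝟙 K) ⟩ ≡ + s * (+ s - + 1)
      ⟨𝟙K,A𝟙K⟩ = trans (sum-cong-≗ pointwise)
                   (trans (sym (*-distribʳ-sum (+ s - + 1) (𝟙 K))) (cong (_* (+ s - + 1)) ∑𝟙K))
        where
        pointwise : ∀ x → 𝟙 K x * A (𝟙 K) x ≡ 𝟙 K x * (+ s - + 1)
        pointwise x with K x in x∈K
        ... | true  = cong (+ 1 *_) (A𝟙K-inside x∈K)
        ... | false = refl

      A-family-at : ∀ x → A (𝟙 K) (p x) ≡ + Configuration.nbrsInK C x
      A-family-at x = trans (A-𝟙 K (p x)) (cong +_ (matches-nbrsInK x))

      𝟙K-at : ∀ x → 𝟙 K (p x) ≡ + 0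
      𝟙K-at x = cong ⟦_⟧ (outside-K x)

    inner-family : ∀ i j → ⟨ family p i , family p j ⟩ ≡ inner C i j
    inner-family zero          zero          = trans (∑-const v (+ 1)) (ℤP.*-identityʳ (+ v))
    inner-family zero          (suc zero)    = trans (⟨1,⟩ (𝟙 K)) ∑𝟙K
    inner-family zero          (suc (suc j)) = ⟨,δ⟩ _ (p j)
    inner-family (suc zero)    zero          = trans (⟨⟩-comm (𝟙 K) _) (trans (⟨1,⟩ (𝟙 K)) ∑𝟙K)
    inner-family (suc zero)    (suc zero)    =
      trans (sum-cong-≗ (λ x → trans (sym (⟦∧⟧ (K x) (K x))) (cong ⟦_⟧ (∧-idem (K x))))) ∑𝟙K
    inner-family (suc zero)    (suc (suc j)) = trans (⟨,δ⟩ (𝟙 K) (p j)) (𝟙K-at j)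
    inner-family (suc (suc i)) zero          = ⟨δ,⟩ (p i) _
    inner-family (suc (suc i)) (suc zero)    = trans (⟨δ,⟩ (p i) (𝟙 K)) (𝟙K-at i)
    inner-family (suc (suc i)) (suc (suc j)) =
      trans (⟨δ,⟩ (p i) (δ (p j))) (trans (δ-sym (p j) (p i)) (δ-injective injective i j))

    innerA-family : ∀ i j → ⟨ family p i , A (family p j) ⟩ ≡ innerA C i j
    innerA-family zero          zero          = trans (⟨1,A⟩ _) (trans (cong (+ k *_) (inner-family zero zero))
                                                                        (ℤP.*-comm (+ k) (+ v)))
    innerA-family zero          (suc zero)    = trans (⟨1,A⟩ (𝟙 K)) (cong (+ k *_) ∑𝟙K)
    innerA-family zero          (suc (suc j)) =
      trans (A-self-adjoint (λ _ → + 1) (δ (p j))) (trans (⟨,δ⟩ (A (λ _ → + 1)) (p j)) (A-const (p j)))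
    innerA-family (suc zero)    zero          = trans (⟨,A1⟩ (𝟙 K)) (cong (_* + k) ∑𝟙K)
    innerA-family (suc zero)    (suc zero)    = ⟨𝟙K,A𝟙K⟩
    innerA-family (suc zero)    (suc (suc j)) =
      trans (A-self-adjoint (𝟙 K) (δ (p j))) (trans (⟨,δ⟩ (A (𝟙 K)) (p j)) (A-family-at j))
    innerA-family (suc (suc i)) zero          = trans (⟨δ,⟩ (p i) (A (λ _ → + 1))) (A-const (p i))
    innerA-family (suc (suc i)) (suc zero)    = trans (⟨δ,⟩ (p i) (A (𝟙 K))) (A-family-at i)
    innerA-family (suc (suc i)) (suc (suc j)) =
      trans (⟨δ,⟩ (p i) (A (δ (p j)))) (trans (A-δ (p j) (p i)) (cong ⟦_⟧ (matches-adjacent i j)))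

    sum-family : ∀ i → sum (family p i) ≡ sums C i
    sum-family zero          = inner-family zero zero
    sum-family (suc zero)    = ∑𝟙K
    sum-family (suc (suc i)) = trans (sym (⟨1,⟩ (δ (p i)))) (⟨,δ⟩ _ (p i))

    B-family : ∀ r i j → B r (family p i) (family p j) ≡ gram C r i j
    B-family r i j =
      cong₂ _+_ (cong₂ _+_ (cong (α r *_) (inner-family i j)) (cong (β r *_) (innerA-family i j)))
                (cong (+ μ *_) (cong₂ _*_ (sum-family i) (sum-family j)))

    realisable⇒gram-psd : ∀ r c → + 0 ≤ quadraticForm (gram C r) c
    realisable⇒gram-psd r c =
      subst (+ 0 ≤_) (sum-cong-≗ (λ i → cong (c i *_) (sum-cong-≗ (λ j → cong (c j *_) (B-family r i j)))))
        (B-psd r (family p) c)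

  triple-realised : ∀ {n₀ n₁ n₂ b₀₁ b₀₂ b₁₂ p₀ p₁ p₂} →
    layer G K n₀ p₀ ≡ true → layer G K n₁ p₁ ≡ true → layer G K n₂ p₂ ≡ true →
    p₀ ≢ p₁ → p₀ ≢ p₂ → p₁ ≢ p₂ →
    adj G p₀ p₁ ≡ b₀₁ → adj G p₀ p₂ ≡ b₀₂ → adj G p₁ p₂ ≡ b₁₂ →
    Realises (triple n₀ n₁ n₂ b₀₁ b₀₂ b₁₂) (p₀ ∷ p₁ ∷ p₂ ∷ [])
  triple-realised {n₀} {n₁} {n₂} {b₀₁} {b₀₂} {b₁₂} {p₀} {p₁} {p₂}
                  p₀∈ p₁∈ p₂∈ p₀≢p₁ p₀≢p₂ p₁≢p₂ e₀₁ e₀₂ e₁₂ = record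
    { injective        = injective
    ; outside-K        = λ { zero → layer-outside p₀∈ ; (suc zero) → layer-outside p₁∈
                           ; (suc (suc zero)) → layer-outside p₂∈ }
    ; matches-nbrsInK  = λ { zero → layer-nbrsIn p₀∈ ; (suc zero) → layer-nbrsIn p₁∈
                           ; (suc (suc zero)) → layer-nbrsIn p₂∈ }
    ; matches-adjacent = adjacent
    }
    where
    injective : Injective _≡_ _≡_ (p₀ ∷ p₁ ∷ p₂ ∷ [])
    injective {zero}          {zero}          _ = refl
    injective {zero}          {suc zero}      e = ⊥-elim (p₀≢p₁ e)
    injective {zero}          {suc (suc zero)} e = ⊥-elim (p₀≢p₂ e)
    injective {suc zero}      {zero}          e = ⊥-elim (p₀≢p₁ (sym e))
    injective {suc zero}      {suc zero}      _ = refl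
    injective {suc zero}      {suc (suc zero)} e = ⊥-elim (p₁≢p₂ e)
    injective {suc (suc zero)} {zero}          e = ⊥-elim (p₀≢p₂ (sym e))
    injective {suc (suc zero)} {suc zero}      e = ⊥-elim (p₁≢p₂ (sym e))
    injective {suc (suc zero)} {suc (suc zero)} _ = refl
    adjacent : ∀ i j → adj G ((p₀ ∷ p₁ ∷ p₂ ∷ []) i) ((p₀ ∷ p₁ ∷ p₂ ∷ []) j)
                     ≡ Configuration.adjacent (triple n₀ n₁ n₂ b₀₁ b₀₂ b₁₂) i j
    adjacent zero             zero             = adj-irrefl G p₀
    adjacent zero             (suc zero)       = e₀₁
    adjacent zero             (suc (suc zero)) = e₀₂
    adjacent (suc zero)       zero             = trans (adj-sym G p₁ p₀) e₀₁
    adjacent (suc zero)       (suc zero)       = adj-irrefl G p₁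
    adjacent (suc zero)       (suc (suc zero)) = e₁₂
    adjacent (suc (suc zero)) zero             = trans (adj-sym G p₂ p₀) e₀₂
    adjacent (suc (suc zero)) (suc zero)       = trans (adj-sym G p₂ p₁) e₁₂
    adjacent (suc (suc zero)) (suc (suc zero)) = adj-irrefl G p₂

solve-degree-equations : ∀ n₀ n₁ n₂ n₃ →
  n₀ + n₁ + n₂ + n₃ ≡ + 40 × n₁ + + 2 * n₂ + + 3 * n₃ ≡ + 80 →
  n₁ ≡ n₃ - + 2 * n₀ × n₂ ≡ + 40 + n₀ - + 2 * n₃
solve-degree-equations n₀ n₁ n₂ n₃ (E₁ , E₂) =
  trans (identity₁ n₀ n₁ n₂ n₃) (trans (cong₂ (λ d₁ d₂ → n₃ - + 2 * n₀ + + 2 * d₁ - d₂) D₁ D₂) (drop-zeros _)) ,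
  trans (identity₂ n₀ n₁ n₂ n₃) (trans (cong₂ (λ d₁ d₂ → + 40 + n₀ - + 2 * n₃ - d₁ + d₂) D₁ D₂) (drop-zeros _))
  where
  D₁ : n₀ + n₁ + n₂ + n₃ - + 40 ≡ + 0
  D₁ = ℤP.i≡j⇒i-j≡0 E₁
  D₂ : n₁ + + 2 * n₂ + + 3 * n₃ - + 80 ≡ + 0
  D₂ = ℤP.i≡j⇒i-j≡0 E₂
  identity₁ : ∀ n₀ n₁ n₂ n₃ →
    n₁ ≡ n₃ - + 2 * n₀ + + 2 * (n₀ + n₁ + n₂ + n₃ - + 40) - (n₁ + + 2 * n₂ + + 3 * n₃ - + 80)
  identity₁ = solve-∀
  identity₂ : ∀ n₀ n₁ n₂ n₃ →
    n₂ ≡ + 40 + n₀ - + 2 * n₃ - (n₀ + n₁ + n₂ + n₃ - + 40) + (n₁ + + 2 * n₂ + + 3 * n₃ - + 80)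
  identity₂ = solve-∀
  drop-zeros : ∀ x → x + + 0 + + 0 ≡ x
  drop-zeros = solve-∀

module FourCliqueLayers
  (G : Graph 95) (srg : IsSRG G 40 12 20) (K : Subset 95) (K-clique : IsKClique G 4 K)
  (|X₀| : count (layer G K 0) ≡ 2) (|X₁| : count (layer G K 1) ≡ 31)
  (|X₂| : count (layer G K 2) ≡ 57) (|X₃| : count (layer G K 3) ≡ 1)
  {x₀ x₁ : Fin 95} (x₀∈X₀ : layer G K 0 x₀ ≡ true) (x₁∈X₀ : layer G K 0 x₁ ≡ true) (x₀≢x₁ : x₀ ≢ x₁)
  where

  open Adjacency G
  open StronglyRegular srg
  open IsSRG srg
  open Layers G K
  open Clique srg K (proj₁ K-clique) (proj₂ K-clique)

  X : ℕ → Subset 95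
  X = layer G K

  ∣_∩_∣ : Subset 95 → Subset 95 → ℤ
  ∣ S ∩ Q ∣ = + count (λ z → S z ∧ Q z)

  cover : ∀ z → lincomb (λ _ → + 1) (𝟙 ∘ parts) z ≡ + 1
  cover = parts-cover part-sizes
    where
    part-sizes : ∑[ i < 5 ] (+ count (parts i)) ≡ + 95
    part-sizes = cong₂ _+_ (cong +_ (proj₂ K-clique)) (cong₂ _+_ (cong +_ |X₀|) (cong₂ _+_ (cong +_ |X₁|)
                   (cong₂ _+_ (cong +_ |X₂|) (cong₂ _+_ (cong +_ |X₃|) (refl {x = + 0})))))

  ⟨lincomb-parts,𝟙⟩ : ∀ (c : Vector ℤ 5) Q →
                      ⟨ lincomb c (𝟙 ∘ parts) , 𝟙 Q ⟩ ≡ ∑[ i < 5 ] (c i * ∣ parts i ∩ Q ∣)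
  ⟨lincomb-parts,𝟙⟩ c Q =
    trans (⟨lincomb,⟩ c (𝟙 ∘ parts) (𝟙 Q)) (sum-cong-≗ (λ i → cong (c i *_) (⟨𝟙,𝟙⟩ (parts i) Q)))

  count-split : ∀ Q → + count Q ≡ ∣ K ∩ Q ∣ + ∣ X 0 ∩ Q ∣ + ∣ X 1 ∩ Q ∣ + ∣ X 2 ∩ Q ∣ + ∣ X 3 ∩ Q ∣
  count-split Q = trans (count≡∑𝟙 Q) (trans (sym (⟨1,⟩ (𝟙 Q)))
    (trans (⟨⟩-congˡ (𝟙 Q) (sym ∘ cover)) (trans (⟨lincomb-parts,𝟙⟩ (λ _ → + 1) Q)
      (collect ∣ K ∩ Q ∣ ∣ X 0 ∩ Q ∣ ∣ X 1 ∩ Q ∣ ∣ X 2 ∩ Q ∣ ∣ X 3 ∩ Q ∣))))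
    where
    collect : ∀ a b c d e → + 1 * a + (+ 1 * b + (+ 1 * c + (+ 1 * d + (+ 1 * e + + 0)))) ≡ a + b + c + d + e
    collect = solve-∀

  A𝟙K-split : ∀ Q →
    ⟨ A (𝟙 K) , 𝟙 Q ⟩ ≡ + 3 * ∣ K ∩ Q ∣ + ∣ X 1 ∩ Q ∣ + + 2 * ∣ X 2 ∩ Q ∣ + + 3 * ∣ X 3 ∩ Q ∣
  A𝟙K-split Q = begin
    ⟨ A (𝟙 K) , 𝟙 Q ⟩                              ≡⟨ ⟨⟩-congˡ (𝟙 Q) (A𝟙K-by-parts cover) ⟩
    ⟨ lincomb weights (𝟙 ∘ parts) , 𝟙 Q ⟩      ≡⟨ ⟨lincomb-parts,𝟙⟩ weights Q ⟩
    ∑[ i < 5 ] (weights i * ∣ parts i ∩ Q ∣)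
      ≡⟨ collect ∣ K ∩ Q ∣ ∣ X 0 ∩ Q ∣ ∣ X 1 ∩ Q ∣ ∣ X 2 ∩ Q ∣ ∣ X 3 ∩ Q ∣ ⟩
    + 3 * ∣ K ∩ Q ∣ + ∣ X 1 ∩ Q ∣ + + 2 * ∣ X 2 ∩ Q ∣ + + 3 * ∣ X 3 ∩ Q ∣ ∎
    where
    open ≡-Reasoning
    collect : ∀ a b c d e → + 3 * a + (+ 0 * b + (+ 1 * c + (+ 2 * d + (+ 3 * e + + 0))))
                          ≡ + 3 * a + c + + 2 * d + + 3 * e
    collect = solve-∀

  w : Fin 95
  w = proj₁ (count≡suc⇒∃ (X 3) |X₃|)

  w∈X₃ : X 3 w ≡ true
  w∈X₃ = proj₂ (count≡suc⇒∃ (X 3) |X₃|)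

  ∣X₀∩_∣ : ∀ Q → ∣ X 0 ∩ Q ∣ ≡ ⟦ Q x₀ ⟧ + ⟦ Q x₁ ⟧
  ∣X₀∩ Q ∣ = begin
    ∣ X 0 ∩ Q ∣                                  ≡⟨ sym (⟨𝟙,𝟙⟩ (X 0) Q) ⟩
    ⟨ 𝟙 (X 0) , 𝟙 Q ⟩
      ≡⟨ ⟨⟩-congˡ (𝟙 Q) (𝟙≡δ+δ {S = X 0} x₀∈X₀ x₁∈X₀ x₀≢x₁ |X₀|) ⟩
    ∑[ z < 95 ] ((δ x₀ z + δ x₁ z) * 𝟙 Q z)
      ≡⟨ sum-cong-≗ (λ z → ℤP.*-distribʳ-+ (𝟙 Q z) (δ x₀ z) (δ x₁ z)) ⟩
    ∑[ z < 95 ] (δ x₀ z * 𝟙 Q z + δ x₁ z * 𝟙 Q z)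
      ≡⟨ ∑-distrib-+ (λ z → δ x₀ z * 𝟙 Q z) (λ z → δ x₁ z * 𝟙 Q z) ⟩
    ⟨ δ x₀ , 𝟙 Q ⟩ + ⟨ δ x₁ , 𝟙 Q ⟩               ≡⟨ cong₂ _+_ (⟨δ,⟩ x₀ (𝟙 Q)) (⟨δ,⟩ x₁ (𝟙 Q)) ⟩
    ⟦ Q x₀ ⟧ + ⟦ Q x₁ ⟧                          ∎
    where open ≡-Reasoning

  ∣X₃∩_∣ : ∀ Q → ∣ X 3 ∩ Q ∣ ≡ ⟦ Q w ⟧
  ∣X₃∩ Q ∣ = trans (sym (⟨𝟙,𝟙⟩ (X 3) Q)) (trans (⟨⟩-congˡ (𝟙 Q) (𝟙≡δ {S = X 3} w∈X₃ |X₃|)) (⟨δ,⟩ w (𝟙 Q)))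

  X₀-degree-equations : ∀ {p} → X 0 p ≡ true →
    ∣ X 0 ∩ adj G p ∣ + ∣ X 1 ∩ adj G p ∣ + ∣ X 2 ∩ adj G p ∣ + ∣ X 3 ∩ adj G p ∣ ≡ + 40 ×
    ∣ X 1 ∩ adj G p ∣ + + 2 * ∣ X 2 ∩ adj G p ∣ + + 3 * ∣ X 3 ∩ adj G p ∣ ≡ + 80
  X₀-degree-equations {p} p∈X₀ = E₁ , E₂
    where
    open ≡-Reasoning
    n : ℕ → ℤ
    n i = ∣ X i ∩ adj G p ∣
    K∩N[p] : ∣ K ∩ adj G p ∣ ≡ + 0
    K∩N[p] = cong +_ (layer-nbrsIn p∈X₀)
    E₁ : n 0 + n 1 + n 2 + n 3 ≡ + 40
    E₁ = begin
      n 0 + n 1 + n 2 + n 3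
        ≡⟨ cong (λ t → t + n 1 + n 2 + n 3) (sym (ℤP.+-identityˡ (n 0))) ⟩
      + 0 + n 0 + n 1 + n 2 + n 3
        ≡⟨ cong (λ t → t + n 0 + n 1 + n 2 + n 3) (sym K∩N[p]) ⟩
      ∣ K ∩ adj G p ∣ + n 0 + n 1 + n 2 + n 3     ≡⟨ sym (count-split (adj G p)) ⟩
      + count (adj G p)                           ≡⟨ cong +_ (regular p) ⟩
      + 40                                        ∎
    E₂ : n 1 + + 2 * n 2 + + 3 * n 3 ≡ + 80
    E₂ = begin
      n 1 + + 2 * n 2 + + 3 * n 3
        ≡⟨ cong (λ t → t + + 2 * n 2 + + 3 * n 3) (sym (ℤP.+-identityˡ (n 1))) ⟩
      + 3 * + 0 + n 1 + + 2 * n 2 + + 3 * n 3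
        ≡⟨ cong (λ t → + 3 * t + n 1 + + 2 * n 2 + + 3 * n 3) (sym K∩N[p]) ⟩
      + 3 * ∣ K ∩ adj G p ∣ + n 1 + + 2 * n 2 + + 3 * n 3 ≡⟨ sym (A𝟙K-split (adj G p)) ⟩
      ⟨ A (𝟙 K) , a p ⟩
        ≡⟨ trans (⟨⟩-comm (A (𝟙 K)) (a p)) (A² (𝟙 K) p) ⟩
      (+ 40 - + 20) * 𝟙 K p + (+ 12 - + 20) * A (𝟙 K) p + + 20 * sum (𝟙 K)
          ≡⟨ cong₂ (λ x y → (+ 40 - + 20) * x + (+ 12 - + 20) * y + + 20 * sum (𝟙 K))
                   (cong ⟦_⟧ (layer-outside p∈X₀)) (trans (A-𝟙 K p) (cong +_ (layer-nbrsIn p∈X₀))) ⟩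
      (+ 40 - + 20) * + 0 + (+ 12 - + 20) * + 0 + + 20 * sum (𝟙 K)
          ≡⟨ cong (λ t → (+ 40 - + 20) * + 0 + (+ 12 - + 20) * + 0 + + 20 * t) ∑𝟙K ⟩
      + 80                                              ∎

  X₀-neighbour-counts : ∀ {p} → X 0 p ≡ true →
    ∣ X 1 ∩ adj G p ∣ ≡ ⟦ adj G p w ⟧ - + 2 * (⟦ adj G p x₀ ⟧ + ⟦ adj G p x₁ ⟧) ×
    ∣ X 2 ∩ adj G p ∣ ≡ + 40 + (⟦ adj G p x₀ ⟧ + ⟦ adj G p x₁ ⟧) - + 2 * ⟦ adj G p w ⟧
  X₀-neighbour-counts {p} p∈X₀ =
    trans (proj₁ solution) (cong₂ (λ n₃ n₀ → n₃ - + 2 * n₀) (∣X₃∩ adj G p ∣) (∣X₀∩ adj G p ∣)) ,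
    trans (proj₂ solution) (cong₂ (λ n₀ n₃ → + 40 + n₀ - + 2 * n₃) (∣X₀∩ adj G p ∣) (∣X₃∩ adj G p ∣))
    where
    n : ℕ → ℤ
    n i = ∣ X i ∩ adj G p ∣
    solution : n 1 ≡ n 3 - + 2 * n 0 × n 2 ≡ + 40 + n 0 - + 2 * n 3
    solution = solve-degree-equations (n 0) (n 1) (n 2) (n 3) (X₀-degree-equations p∈X₀)

  x₀≁x₁ : adj G x₀ x₁ ≡ false
  x₀≁x₁ = nonneg⇒false (adj G x₀ x₁) (adj G x₀ w)
    (subst (+ 0 ≤_) (trans (proj₁ (X₀-neighbour-counts x₀∈X₀))
                           (cong (λ t → ⟦ adj G x₀ w ⟧ - + 2 * (t + ⟦ adj G x₀ x₁ ⟧)) (a-irrefl x₀)))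
      (+≤+ z≤n))
    where
    nonneg⇒false : ∀ b c → + 0 ≤ ⟦ c ⟧ - + 2 * (+ 0 + ⟦ b ⟧) → b ≡ false
    nonneg⇒false false c     _ = refl
    nonneg⇒false true  true  ()
    nonneg⇒false true  false ()

  private
    -[1+]≱0 : ∀ {n} → ¬ (+ 0 ≤ -[1+ n ])
    -[1+]≱0 ()

  -- The coefficient vectors are negative directions of the Gram matrices, read off an LDLᵀ decomposition.
  X₀-adjacent-to-w : ∀ {p q} → X 0 p ≡ true → X 0 q ≡ true → p ≢ q → adj G p q ≡ false → adj G p w ≡ true
  X₀-adjacent-to-w {p} {q} p∈X₀ q∈X₀ p≢q p≁q = by-cases (adj G p w) (adj G q w) refl refl
    where
    c : Vector ℤ 5
    c = + 6 ∷ -[1+ 170 ] ∷ + 114 ∷ + 76 ∷ -[1+ 75 ] ∷ []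
    realised : ∀ {b b′} → adj G p w ≡ b → adj G q w ≡ b′ →
               Realises (triple 0 0 3 false b b′) (p ∷ q ∷ w ∷ [])
    realised = triple-realised p∈X₀ q∈X₀ w∈X₃ p≢q
                 (layers-disjoint p∈X₀ w∈X₃ (λ ())) (layers-disjoint q∈X₀ w∈X₃ (λ ())) p≁q
    by-cases : ∀ b b′ → adj G p w ≡ b → adj G q w ≡ b′ → adj G p w ≡ true
    by-cases true  _     p~w _   = p~w
    by-cases false true  p≁w q~w = ⊥-elim (-[1+]≱0 (realisable⇒gram-psd (realised p≁w q~w) (+ 2) c))
    by-cases false false p≁w q≁w = ⊥-elim (-[1+]≱0 (realisable⇒gram-psd (realised p≁w q≁w) (+ 2) c))

  no-common-neighbour-in-X₁ : ∀ {y} → X 1 y ≡ true → adj G x₀ y ≡ true → adj G x₁ y ≡ true → ⊥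
  no-common-neighbour-in-X₁ {y} y∈X₁ x₀~y x₁~y = -[1+]≱0 (realisable⇒gram-psd realised (+ 2) c)
    where
    c : Vector ℤ 5
    c = + 4 ∷ -[1+ 170 ] ∷ + 114 ∷ + 114 ∷ + 76 ∷ []
    realised : Realises (triple 0 0 1 false true true) (x₀ ∷ x₁ ∷ y ∷ [])
    realised = triple-realised x₀∈X₀ x₁∈X₀ y∈X₁ x₀≢x₁ (layers-disjoint x₀∈X₀ y∈X₁ (λ ()))
                 (layers-disjoint x₁∈X₀ y∈X₁ (λ ())) x₀≁x₁ x₀~y x₁~y

  x₀~w : adj G x₀ w ≡ true
  x₀~w = X₀-adjacent-to-w x₀∈X₀ x₁∈X₀ x₀≢x₁ x₀≁x₁

  x₁~w : adj G x₁ w ≡ true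
  x₁~w = X₀-adjacent-to-w x₁∈X₀ x₀∈X₀ (x₀≢x₁ ∘ sym) (trans (adj-sym G x₁ x₀) x₀≁x₁)

  X₀-vertex-counts : ∀ {p} → X 0 p ≡ true → adj G p x₀ ≡ false → adj G p x₁ ≡ false → adj G p w ≡ true →
                     nbrsIn G (X 1) p ≡ 1 × nbrsIn G (X 2) p ≡ 38
  X₀-vertex-counts {p} p∈X₀ p≁x₀ p≁x₁ p~w =
    ℤP.+-injective (trans (proj₁ (X₀-neighbour-counts p∈X₀)) (cong₂ (λ b n₀ → ⟦ b ⟧ - + 2 * n₀) p~w n₀≡0)) ,
    ℤP.+-injective (trans (proj₂ (X₀-neighbour-counts p∈X₀)) (cong₂ (λ n₀ b → + 40 + n₀ - + 2 * ⟦ b ⟧) n₀≡0 p~w))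
    where
    n₀≡0 : ⟦ adj G p x₀ ⟧ + ⟦ adj G p x₁ ⟧ ≡ + 0
    n₀≡0 = cong₂ (λ b b′ → ⟦ b ⟧ + ⟦ b′ ⟧) p≁x₀ p≁x₁

  common-in-X₂ : count (λ y → X 2 y ∧ adj G x₀ y ∧ adj G x₁ y) ≡ 19
  common-in-X₂ = ℤP.+-injective (solve in-K in-X₀ in-X₁ in-X₃ (trans (sym (count-split common)) total))
    where
    common : Subset 95
    common z = adj G x₀ z ∧ adj G x₁ z
    total : + count common ≡ + 20
    total = cong +_ (nonadjCommon x₀ x₁ x₀≢x₁ x₀≁x₁)
    in-K : ∣ K ∩ common ∣ ≡ + 0
    in-K = cong +_ (count-cong λ z →
      trans (sym (∧-assoc (K z) (adj G x₀ z) (adj G x₁ z)))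
            (cong (_∧ adj G x₁ z) (count≡0⇒false (λ y → K y ∧ adj G x₀ y) (layer-nbrsIn x₀∈X₀) z)))
    in-X₀ : ∣ X 0 ∩ common ∣ ≡ + 0
    in-X₀ = trans (∣X₀∩ common ∣)
              (cong₂ (λ b b′ → ⟦ b ∧ adj G x₁ x₀ ⟧ + ⟦ b′ ∧ adj G x₁ x₁ ⟧) (adj-irrefl G x₀) x₀≁x₁)
    in-X₁ : ∣ X 1 ∩ common ∣ ≡ + 0
    in-X₁ = cong +_ (count-cong λ z → none (X 1 z) (adj G x₀ z) (adj G x₁ z) no-common-neighbour-in-X₁)
      where
      none : ∀ a b c → (a ≡ true → b ≡ true → c ≡ true → ⊥) → a ∧ b ∧ c ≡ false
      none true  true  true  h = ⊥-elim (h refl refl refl)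
      none true  true  false _ = refl
      none true  false c     _ = refl
      none false b     c     _ = refl
    in-X₃ : ∣ X 3 ∩ common ∣ ≡ + 1
    in-X₃ = trans (∣X₃∩ common ∣) (cong ⟦_⟧ (cong₂ _∧_ x₀~w x₁~w))
    solve : ∀ {k₀ k₁ k₂ k₃ t} → k₀ ≡ + 0 → k₁ ≡ + 0 → k₂ ≡ + 0 → k₃ ≡ + 1 →
            k₀ + k₁ + k₂ + t + k₃ ≡ + 20 → t ≡ + 19
    solve {t = t} refl refl refl refl eq = trans (lemma t) (cong (_- + 1) eq)
      where
      lemma : ∀ t → t ≡ + 0 + + 0 + + 0 + t + + 1 - + 1
      lemma = solve-∀

lemma12 : (G : Graph 95) → IsSRG G 40 12 20 →
    (K : Subset 95) → IsKClique G 4 K →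
    (¬ ∃ λ (L : Subset 95) → IsKClique G 5 L × K ⊆ L) →
    count (layer G K 0) ≡ 2 → count (layer G K 1) ≡ 31 →
    count (layer G K 2) ≡ 57 → count (layer G K 3) ≡ 1 →
    (x₀ x₁ : Fin 95) → layer G K 0 x₀ ≡ true → layer G K 0 x₁ ≡ true → x₀ ≢ x₁ →
    (nbrsIn G (layer G K 1) x₀ ≡ 1 × nbrsIn G (layer G K 1) x₁ ≡ 1 ×
     (∀ y z → layer G K 1 y ≡ true → adj G x₀ y ≡ true →
              layer G K 1 z ≡ true → adj G x₁ z ≡ true → y ≢ z)) ×
    (nbrsIn G (layer G K 2) x₀ ≡ 38 × nbrsIn G (layer G K 2) x₁ ≡ 38 ×
     count (λ y → layer G K 2 y ∧ adj G x₀ y ∧ adj G x₁ y) ≡ 19)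
lemma12 G srg K K-clique _ |X₀| |X₁| |X₂| |X₃| x₀ x₁ x₀∈X₀ x₁∈X₀ x₀≢x₁ =
  (proj₁ x₀-counts , proj₁ x₁-counts , distinct) , (proj₂ x₀-counts , proj₂ x₁-counts , common-in-X₂)
  where
  open FourCliqueLayers G srg K K-clique |X₀| |X₁| |X₂| |X₃| x₀∈X₀ x₁∈X₀ x₀≢x₁
  x₀-counts : nbrsIn G (layer G K 1) x₀ ≡ 1 × nbrsIn G (layer G K 2) x₀ ≡ 38
  x₀-counts = X₀-vertex-counts x₀∈X₀ (adj-irrefl G x₀) x₀≁x₁ x₀~w
  x₁-counts : nbrsIn G (layer G K 1) x₁ ≡ 1 × nbrsIn G (layer G K 2) x₁ ≡ 38
  x₁-counts = X₀-vertex-counts x₁∈X₀ (trans (adj-sym G x₁ x₀) x₀≁x₁) (adj-irrefl G x₁) x₁~w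
  distinct : ∀ y z → layer G K 1 y ≡ true → adj G x₀ y ≡ true →
             layer G K 1 z ≡ true → adj G x₁ z ≡ true → y ≢ z
  distinct y _ y∈X₁ x₀~y _ x₁~y refl = no-common-neighbour-in-X₁ y∈X₁ x₀~y x₁~y
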